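{- Let $h\ge0$, $m=2h+1$, $q=3^m$, $\alpha=3^{h+1}$, and for $a\in\mathbb{F}_q$ let $f_a(x)=x^{2\alpha+3}+(ax)^{\alpha}-a^2x$, which is a permutation polynomial of $\mathbb{F}_q$. For nonzero $a\in\mathbb{F}_q$ let $D_a=\{f_a(x^2)\mid x\in\mathbb{F}_q^*\}$. Then $D_a\cap(-D_a)=\emptyset$ and $D_a\cup(-D_a)\cup\{0\}=\mathbb{F}_q$. -}

module Defs where

open import Level using (Level)
open import Data.Nat using (ℕ)
import Data.Nat
open import Data.Fin using (Fin)
open import Data.Product using (Σ; ∃; _×_)
open import Data.Sum using (_⊎_)
open import Relation.Nullary using (¬_)
open import Relation.Binary.PropositionalEquality using () renaming (setoid to ≡-setoid)
open import Function.Bundles using (Bijection)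
open import Algebra.Bundles using (CommutativeRing)
import Algebra.Bundles
import Algebra.Definitions.RawSemiring as RawSemiringDefs

record IsFiniteField {c ℓ : Level} (F : CommutativeRing c ℓ) (q : ℕ) : Set (c Level.⊔ ℓ) where
  open CommutativeRing F
  field
    0≉1     : ¬ (0# ≈ 1#)
    inverse : ∀ x → ¬ (x ≈ 0#) → ∃ λ y → x * y ≈ 1#
    count   : Bijection setoid (≡-setoid (Fin q))

module _ {c ℓ : Level} (F : CommutativeRing c ℓ) where
  open CommutativeRing F
  open RawSemiringDefs (Algebra.Bundles.Semiring.rawSemiring semiring) using (_^_)

  fpoly : (α : ℕ) → Carrier → Carrier → Carrier
  fpoly α a x = (x ^ (2 Data.Nat.* α Data.Nat.+ 3)) + ((a * x) ^ α) - ((a ^ 2) * x)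

  InD : (α : ℕ) → Carrier → Carrier → Set (c Level.⊔ ℓ)
  InD α a y = ∃ λ x → ¬ (x ≈ 0#) × (y ≈ fpoly α a (x ^ 2))

  InNegD : (α : ℕ) → Carrier → Carrier → Set (c Level.⊔ ℓ)
  InNegD α a y = InD α a (- y)

{-# OPTIONS --safe #-}

-- Write σ x = x ^ α. Since α² = 3q, σ is a ring endomorphism of F with σ (σ x) = x³, and
-- f_a(x) = σ(x)² x³ + σ(a) σ(x) − a² x. For x = t d, y = (t + 1) d and a = b d σ(d) one finds
-- f_a(y) − f_a(x) = σ(d)² d³ Q(σ t, t³, b, σ b) for an explicit polynomial Q. Combining Q = 0
-- with its image under σ forces σ to negate a square root of 1, which is impossible since σ
-- fixes ±1; so f_a is injective, hence a permutation of the finite field F. As f_a is odd and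
-- q ≡ 3 (mod 4), −1 is not a square and every nonzero element is a square or minus a square
-- (Euler's criterion), so f_a maps the nonzero squares onto D_a and the nonsquares onto −D_a.

module Submission where

open import Defs
open import Level using (Level; 0ℓ; _⊔_)
open import Algebra.Bundles using (CommutativeRing; CommutativeMonoid)
open import Algebra.Bundles.Raw using (RawRing)
open import Algebra.Definitions using (AlmostLeftCancellative)
open import Algebra.Morphism.Structures using (module RingMorphisms)
open import Algebra.Solver.Ring.AlmostCommutativeRing
  using (fromCommutativeRing; _-Raw-AlmostCommutative⟶_; Induced-equivalence)
open import Data.Empty using (⊥-elim)
open import Data.Fin as Fin using (Fin; suc; punchIn; punchOut)
open import Data.Fin.Patterns using (0F; 1F; 2F; 3F)
open import Data.Fin.Permutation using (permutation)
import Data.Fin.Properties as Fin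
open import Data.Maybe using (just; nothing)
open import Data.Nat as ℕ using (ℕ)
open import Data.Nat.DivMod using (_%_; _/_; m≡m%n+[m/n]*n)
import Data.Nat.Properties as ℕ
open import Data.Nat.Tactic.RingSolver using (solve-∀)
open import Data.Product using (_×_; _,_; proj₁; proj₂; ∃)
open import Data.Sum using (_⊎_; inj₁; inj₂; [_,_]′)
open import Data.Vec using (Vec; []; _∷_; lookup)
open import Function using (_∘_; id)
open import Function.Bundles using (Bijection; Inverse)
open import Function.Definitions using (Congruent; Injective; StrictlyInverseˡ; StrictlyInverseʳ)
open import Function.Properties.Bijection using (Bijection⇒Inverse)
open import Relation.Binary.Definitions using (Decidable; WeaklyDecidable)
open import Relation.Binary.PropositionalEquality as ≡ using (_≡_; _≢_)
open import Relation.Nullary using (¬_; yes; no; contradiction)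
import Relation.Nullary.Decidable as Dec

open RingMorphisms using (IsRingHomomorphism)

HasCharacteristicThree : {c ℓ : Level} → CommutativeRing c ℓ → Set ℓ
HasCharacteristicThree F = 1# + 1# + 1# ≈ 0#
  where open CommutativeRing F

module CharacteristicThree {c ℓ : Level} (F : CommutativeRing c ℓ) (char3 : HasCharacteristicThree F)
  where

  open CommutativeRing F
  open import Algebra.Properties.Ring ring using (+-inverseʳ-unique; -1*x≈-x)
  open import Algebra.Properties.Semiring.Mult.TCOptimised semiring
    using (×-homo-+; ×1-homo-*) renaming (_×_ to _×′_)
  open import Relation.Binary.Reasoning.Setoid setoid

  -- Coefficients are kept reduced mod 3, so that equal coefficients are syntactically equal,
  -- as the solver's final refl check requires.
  ℤ/3 : RawRing 0ℓ 0ℓ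
  ℤ/3 = record
    { Carrier = ℕ ; _≈_ = _≡_
    ; _+_ = λ m n → (m ℕ.+ n) % 3 ; _*_ = λ m n → (m ℕ.* n) % 3 ; -_ = λ n → (2 ℕ.* n) % 3
    ; 0# = 0 ; 1# = 1
    }

  %3×′1≈×′1 : ∀ n → (n % 3) ×′ 1# ≈ n ×′ 1#
  %3×′1≈×′1 n = begin
    (n % 3) ×′ 1#                          ≈⟨ +-identityʳ _ ⟨
    (n % 3) ×′ 1# + 0#                     ≈⟨ +-congˡ (trans (*-congˡ char3) (zeroʳ _)) ⟨
    (n % 3) ×′ 1# + (n / 3) ×′ 1# * 3 ×′ 1#  ≈⟨ +-congˡ (×1-homo-* (n / 3) 3) ⟨
    (n % 3) ×′ 1# + (n / 3 ℕ.* 3) ×′ 1#     ≈⟨ ×-homo-+ 1# (n % 3) (n / 3 ℕ.* 3) ⟨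
    (n % 3 ℕ.+ n / 3 ℕ.* 3) ×′ 1#          ≡⟨ ≡.cong (_×′ 1#) (m≡m%n+[m/n]*n n 3) ⟨
    n ×′ 1#                                ∎

  1+1≈-1 : 1# + 1# ≈ - 1#
  1+1≈-1 = +-inverseʳ-unique 1# (1# + 1#) (trans (+-comm _ _) char3)

  ℤ/3⟶F : ℤ/3 -Raw-AlmostCommutative⟶ fromCommutativeRing F
  ℤ/3⟶F = record
    { ⟦_⟧    = _×′ 1#
    ; +-homo = λ m n → trans (%3×′1≈×′1 (m ℕ.+ n)) (×-homo-+ 1# m n)
    ; *-homo = λ m n → trans (%3×′1≈×′1 (m ℕ.* n)) (×1-homo-* m n)
    ; -‿homo = λ n → trans (%3×′1≈×′1 (2 ℕ.* n))
                   (trans (×1-homo-* 2 n) (trans (*-congʳ 1+1≈-1) (-1*x≈-x _)))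
    ; 0-homo = refl
    ; 1-homo = refl
    }

  _≟₃_ : WeaklyDecidable (Induced-equivalence ℤ/3⟶F)
  m ≟₃ n with m % 3 ℕ.≟ n % 3
  ... | yes m≡n = just (begin
    m ×′ 1#        ≈⟨ %3×′1≈×′1 m ⟨
    (m % 3) ×′ 1#  ≡⟨ ≡.cong (_×′ 1#) m≡n ⟩
    (n % 3) ×′ 1#  ≈⟨ %3×′1≈×′1 n ⟩
    n ×′ 1#        ∎)
  ... | no _ = nothing

  open import Algebra.Solver.Ring ℤ/3 (fromCommutativeRing F) ℤ/3⟶F _≟₃_ public

  -- Polynomial syntax as a raw ring, so that each formula of the module Formulas is written
  -- once and serves both as a function on F and as input to the solver.
  polynomials : ℕ → RawRing 0ℓ 0ℓ
  polynomials n = record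
    { Carrier = Polynomial n ; _≈_ = _≡_
    ; _+_ = _:+_ ; _*_ = _:*_ ; -_ = :-_ ; 0# = con 0 ; 1# = con 1 }

module Formulas {a ℓ : Level} (R : RawRing a ℓ) where
  open RawRing R

  private
    infixl 6 _-_
    _-_ : Carrier → Carrier → Carrier
    x - y = x + - y

  infix 10 _³
  _³ : Carrier → Carrier
  x ³ = x * x * x

  -- With X = σ x and A = σ a for σ x = x ^ α, G x X a A is f_a(x) = x^(2α+3) + (a x)^α − a² x.
  G : Carrier → Carrier → Carrier → Carrier → Carrier
  G x X a A = X * X * x ³ + A * X - a * a * x

  Q : Carrier → Carrier → Carrier → Carrier → Carrier
  Q t T b B = t * t - t + 1# - t * T + T - b * b + B

  q : Carrier → Carrier → Carrier → Carrier
  q t T b = (b - t) * (b - t) + t * (T + 1#)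

  r : Carrier → Carrier → Carrier → Carrier → Carrier
  r t T b B = B + T + 1# + t * (b - t)

  E : Carrier → Carrier → Carrier → Carrier
  E t T b = t * (T - 1#) * (b - t) - t ³ + (T + 1#) * (T + 1#)

  u : Carrier → Carrier → Carrier
  u t T = t + T + 1#

  v : Carrier → Carrier → Carrier
  v t T = t ³ + T + 1#

  L : Carrier → Carrier → Carrier
  L t T = v t T * u t T ³

module Vanishing {c ℓ : Level} (F : CommutativeRing c ℓ) where
  open CommutativeRing F

  vanishes₁ : ∀ {p c h} → p ≈ c * h → h ≈ 0# → p ≈ 0#
  vanishes₁ p≈ch h≈0 = trans p≈ch (trans (*-congˡ h≈0) (zeroʳ _))

  vanishes₂ : ∀ {p c₁ h₁ c₂ h₂} → p ≈ c₁ * h₁ + c₂ * h₂ → h₁ ≈ 0# → h₂ ≈ 0# → p ≈ 0#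
  vanishes₂ p≈ch h₁≈0 h₂≈0 =
    trans p≈ch (trans (+-cong (vanishes₁ refl h₁≈0) (vanishes₁ refl h₂≈0)) (+-identityʳ 0#))

  vanishes₃ : ∀ {p c₁ h₁ c₂ h₂ c₃ h₃} → p ≈ c₁ * h₁ + c₂ * h₂ + c₃ * h₃ →
              h₁ ≈ 0# → h₂ ≈ 0# → h₃ ≈ 0# → p ≈ 0#
  vanishes₃ p≈ch h₁≈0 h₂≈0 h₃≈0 =
    trans p≈ch (trans (+-cong (vanishes₂ refl h₁≈0 h₂≈0) (vanishes₁ refl h₃≈0)) (+-identityʳ 0#))

module _ {c ℓ : Level} (F : CommutativeRing c ℓ) where
  open CommutativeRing F
  open import Algebra.Properties.Ring ring using (+-inverseʳ-unique; x+x≈x⇒x≈0)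

  +-*-1#-homo⇒isRingHomomorphism : ∀ {φ : Carrier → Carrier} → Congruent _≈_ _≈_ φ →
    (∀ x y → φ (x + y) ≈ φ x + φ y) → (∀ x y → φ (x * y) ≈ φ x * φ y) → φ 1# ≈ 1# →
    IsRingHomomorphism rawRing rawRing φ
  +-*-1#-homo⇒isRingHomomorphism {φ} φ-cong +-homo *-homo 1#-homo = record
    { isSemiringHomomorphism = record
      { isNearSemiringHomomorphism = record
        { +-isMonoidHomomorphism = record
          { isMagmaHomomorphism = record
            { isRelHomomorphism = record { cong = φ-cong }
            ; homo = +-homo }
          ; ε-homo = 0#-homo }
        ; *-homo = *-homo }
      ; 1#-homo = 1#-homo }
    ; -‿homo = λ x → +-inverseʳ-unique (φ x) (φ (- x))
                       (trans (sym (+-homo x (- x))) (trans (φ-cong (-‿inverseʳ x)) 0#-homo)) }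
    where
    0#-homo : φ 0# ≈ 0#
    0#-homo = x+x≈x⇒x≈0 (φ 0#) (trans (sym (+-homo 0# 0#)) (φ-cong (+-identityʳ 0#)))

module Powers {c ℓ : Level} (F : CommutativeRing c ℓ) where
  open CommutativeRing F
  open import Algebra.Properties.Ring ring using (-‿distribˡ-*; -‿distribʳ-*; -‿involutive)
  open import Algebra.Properties.Semiring.Exp semiring using (_^_; ^-congˡ; ^-assocʳ)
  open import Relation.Binary.Reasoning.Setoid setoid

  1^n≈1 : ∀ n → 1# ^ n ≈ 1#
  1^n≈1 ℕ.zero    = refl
  1^n≈1 (ℕ.suc n) = trans (*-identityˡ _) (1^n≈1 n)

  [-x]^2≈x^2 : ∀ x → (- x) ^ 2 ≈ x ^ 2
  [-x]^2≈x^2 x = begin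
    - x * (- x * 1#)        ≈⟨ -‿distribˡ-* x _ ⟨
    - (x * (- x * 1#))      ≈⟨ -‿cong (*-congˡ (-‿distribˡ-* x 1#)) ⟨
    - (x * - (x * 1#))      ≈⟨ -‿cong (-‿distribʳ-* x _) ⟨
    - - (x * (x * 1#))      ≈⟨ -‿involutive _ ⟩
    x * (x * 1#)            ∎

  [-x]^[1+2k]≈-[x^[1+2k]] : ∀ x k → (- x) ^ (1 ℕ.+ 2 ℕ.* k) ≈ - (x ^ (1 ℕ.+ 2 ℕ.* k))
  [-x]^[1+2k]≈-[x^[1+2k]] x k = begin
    - x * (- x) ^ (2 ℕ.* k)  ≈⟨ *-congˡ (^-assocʳ (- x) 2 k) ⟨
    - x * ((- x) ^ 2) ^ k    ≈⟨ *-congˡ (^-congˡ k ([-x]^2≈x^2 x)) ⟩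
    - x * (x ^ 2) ^ k        ≈⟨ *-congˡ (^-assocʳ x 2 k) ⟩
    - x * x ^ (2 ℕ.* k)      ≈⟨ -‿distribˡ-* x _ ⟨
    - (x * x ^ (2 ℕ.* k))    ∎

record IsDiscreteField {c ℓ : Level} (F : CommutativeRing c ℓ) : Set (c ⊔ ℓ) where
  open CommutativeRing F
  field
    0≉1     : 0# ≉ 1#
    inverse : ∀ x → x ≉ 0# → ∃ λ y → x * y ≈ 1#
    _≟_     : Decidable _≈_

module DiscreteField {c ℓ : Level} {F : CommutativeRing c ℓ} (isDiscreteField : IsDiscreteField F) where
  open CommutativeRing F
  open IsDiscreteField isDiscreteField public
  open import Algebra.Properties.Semiring.Exp semiring using (_^_)
  open import Algebra.Properties.CommutativeMonoid.Sum *-commutativeMonoid using () renaming (sum to ∏)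
  open import Algebra.Properties.Ring ring
    using (x∙y⁻¹≈ε⇒x≈y; x≈y⇒x∙y⁻¹≈ε; +-inverseˡ-unique; x[y-z]≈xy-xz)
  open import Relation.Binary.Reasoning.Setoid setoid

  *-cancelˡ-nonZero : AlmostLeftCancellative _≈_ 0# _*_
  *-cancelˡ-nonZero x y z x≉0 xy≈xz = begin
    y              ≈⟨ *-identityˡ y ⟨
    1# * y         ≈⟨ *-congʳ x⁻¹x≈1 ⟨
    x⁻¹ * x * y    ≈⟨ *-assoc _ _ _ ⟩
    x⁻¹ * (x * y)  ≈⟨ *-congˡ xy≈xz ⟩
    x⁻¹ * (x * z)  ≈⟨ *-assoc _ _ _ ⟨
    x⁻¹ * x * z    ≈⟨ *-congʳ x⁻¹x≈1 ⟩
    1# * z         ≈⟨ *-identityˡ z ⟩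
    z              ∎
    where
    x⁻¹ = proj₁ (inverse x x≉0)
    x⁻¹x≈1 : x⁻¹ * x ≈ 1#
    x⁻¹x≈1 = trans (*-comm _ _) (proj₂ (inverse x x≉0))

  x*y≈0⇒x≈0⊎y≈0 : ∀ {x y} → x * y ≈ 0# → x ≈ 0# ⊎ y ≈ 0#
  x*y≈0⇒x≈0⊎y≈0 {x} {y} xy≈0 with x ≟ 0#
  ... | yes x≈0 = inj₁ x≈0
  ... | no  x≉0 = inj₂ (*-cancelˡ-nonZero x y 0# x≉0 (trans xy≈0 (sym (zeroʳ x))))

  x≉0∧y≉0⇒x*y≉0 : ∀ {x y} → x ≉ 0# → y ≉ 0# → x * y ≉ 0#
  x≉0∧y≉0⇒x*y≉0 x≉0 y≉0 xy≈0 = [ x≉0 , y≉0 ]′ (x*y≈0⇒x≈0⊎y≈0 xy≈0)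

  x³≈0⇒x≈0 : ∀ {x} → x * x * x ≈ 0# → x ≈ 0#
  x³≈0⇒x≈0 x³≈0 = [ (λ x²≈0 → [ id , id ]′ (x*y≈0⇒x≈0⊎y≈0 x²≈0)) , id ]′ (x*y≈0⇒x≈0⊎y≈0 x³≈0)

  x^n≈0⇒x≈0 : ∀ {x} n → x ^ n ≈ 0# → x ≈ 0#
  x^n≈0⇒x≈0 ℕ.zero    1≈0   = contradiction (sym 1≈0) 0≉1
  x^n≈0⇒x≈0 (ℕ.suc n) xxⁿ≈0 = [ id , x^n≈0⇒x≈0 n ]′ (x*y≈0⇒x≈0⊎y≈0 xxⁿ≈0)

  ∏≉0 : ∀ {m} (v : Fin m → Carrier) → (∀ i → v i ≉ 0#) → ∏ v ≉ 0#
  ∏≉0 {ℕ.zero}  v v≉0 = 0≉1 ∘ sym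
  ∏≉0 {ℕ.suc m} v v≉0 = x≉0∧y≉0⇒x*y≉0 (v≉0 0F) (∏≉0 (v ∘ suc) (v≉0 ∘ suc))

  x*x≈1⇒x≈1⊎x≈-1 : ∀ {x} → x * x ≈ 1# → x ≈ 1# ⊎ x ≈ - 1#
  x*x≈1⇒x≈1⊎x≈-1 {x} x²≈1 =
    [ inj₂ ∘ +-inverseˡ-unique x 1# , inj₁ ∘ x∙y⁻¹≈ε⇒x≈y x 1# ]′ (x*y≈0⇒x≈0⊎y≈0 [x+1][x-1]≈0)
    where
    [x+1][x-1]≈0 : (x + 1#) * (x - 1#) ≈ 0#
    [x+1][x-1]≈0 = begin
      (x + 1#) * (x - 1#)              ≈⟨ distribʳ _ x 1# ⟩
      x * (x - 1#) + 1# * (x - 1#)     ≈⟨ +-cong (x[y-z]≈xy-xz x x 1#) (*-identityˡ _) ⟩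
      (x * x - x * 1#) + (x - 1#)      ≈⟨ +-assoc _ _ _ ⟩
      x * x + (- (x * 1#) + (x - 1#))  ≈⟨ +-congˡ (+-assoc _ _ _) ⟨
      x * x + (- (x * 1#) + x - 1#)    ≈⟨ +-congˡ (+-congʳ (+-congʳ (-‿cong (*-identityʳ x)))) ⟩
      x * x + (- x + x - 1#)           ≈⟨ +-congˡ (+-congʳ (-‿inverseˡ x)) ⟩
      x * x + (0# - 1#)                ≈⟨ +-congˡ (+-identityˡ _) ⟩
      x * x - 1#                       ≈⟨ x≈y⇒x∙y⁻¹≈ε x²≈1 ⟩
      0#                               ∎

record IsSquareRootOfFrobenius {c ℓ : Level} (F : CommutativeRing c ℓ)
  (σ : CommutativeRing.Carrier F → CommutativeRing.Carrier F) : Set (c ⊔ ℓ) where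
  open CommutativeRing F
  field
    isRingHomomorphism : IsRingHomomorphism rawRing rawRing σ
    σ∘σ≈cube           : ∀ x → σ (σ x) ≈ x * x * x

module FrobeniusRoot {c ℓ : Level} {F : CommutativeRing c ℓ} (isDiscreteField : IsDiscreteField F)
  (char3 : HasCharacteristicThree F) {σ : CommutativeRing.Carrier F → CommutativeRing.Carrier F}
  (isSquareRootOfFrobenius : IsSquareRootOfFrobenius F σ) where

  open CommutativeRing F
  open DiscreteField isDiscreteField
  open IsSquareRootOfFrobenius isSquareRootOfFrobenius
  open IsRingHomomorphism isRingHomomorphism
  open CharacteristicThree F char3
    using (Polynomial; ⟦_⟧; op; [+]; [*]; con; var; _:+_; _:*_; _:^_; :-_; _:-_; solve; _:=_; polynomials)
  open Formulas rawRing
  module P {n : ℕ} = Formulas (polynomials n)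
  open Vanishing F
  open import Algebra.Properties.Ring ring
    using (x∙y⁻¹≈ε⇒x≈y; x≈y⇒x∙y⁻¹≈ε; +-inverseˡ-unique)
  open import Algebra.Properties.Semiring.Exp semiring using (_^_; ^-congˡ)
  open import Algebra.Properties.Semiring.Mult.TCOptimised semiring using () renaming (_×_ to _×′_)
  open import Relation.Binary.Reasoning.Setoid setoid

  σ-×′1 : ∀ n → σ (n ×′ 1#) ≈ n ×′ 1#
  σ-×′1 0                   = 0#-homo
  σ-×′1 1                   = 1#-homo
  σ-×′1 (ℕ.suc (ℕ.suc n)) = trans (+-homo _ _) (+-cong (σ-×′1 (ℕ.suc n)) 1#-homo)

  σ-^ : ∀ x n → σ (x ^ n) ≈ σ x ^ n
  σ-^ x ℕ.zero    = 1#-homo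
  σ-^ x (ℕ.suc n) = trans (*-homo _ _) (*-congˡ (σ-^ x n))

  σ-⟦_⟧ : ∀ {n} (p : Polynomial n) (ρ ρ′ : Vec Carrier n) →
          (∀ i → σ (lookup ρ i) ≈ lookup ρ′ i) → σ (⟦ p ⟧ ρ) ≈ ⟦ p ⟧ ρ′
  σ-⟦ op [+] p₁ p₂ ⟧ ρ ρ′ σρ≈ρ′ = trans (+-homo _ _) (+-cong (σ-⟦ p₁ ⟧ ρ ρ′ σρ≈ρ′) (σ-⟦ p₂ ⟧ ρ ρ′ σρ≈ρ′))
  σ-⟦ op [*] p₁ p₂ ⟧ ρ ρ′ σρ≈ρ′ = trans (*-homo _ _) (*-cong (σ-⟦ p₁ ⟧ ρ ρ′ σρ≈ρ′) (σ-⟦ p₂ ⟧ ρ ρ′ σρ≈ρ′))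
  σ-⟦ con k          ⟧ ρ ρ′ σρ≈ρ′ = σ-×′1 k
  σ-⟦ var i          ⟧ ρ ρ′ σρ≈ρ′ = σρ≈ρ′ i
  σ-⟦ p :^ n         ⟧ ρ ρ′ σρ≈ρ′ = trans (σ-^ _ n) (^-congˡ n (σ-⟦ p ⟧ ρ ρ′ σρ≈ρ′))
  σ-⟦ :- p           ⟧ ρ ρ′ σρ≈ρ′ = trans (-‿homo _) (-‿cong (σ-⟦ p ⟧ ρ ρ′ σρ≈ρ′))

  σ-root : ∀ {n} (p : Polynomial n) (ρ ρ′ : Vec Carrier n) →
           (∀ i → σ (lookup ρ i) ≈ lookup ρ′ i) → ⟦ p ⟧ ρ ≈ 0# → ⟦ p ⟧ ρ′ ≈ 0#
  σ-root p ρ ρ′ σρ≈ρ′ p≈0 = trans (sym (σ-⟦ p ⟧ ρ ρ′ σρ≈ρ′)) (trans (⟦⟧-cong p≈0) 0#-homo)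

  x³≈x⇒σx≈x : ∀ {x} → x ³ ≈ x → σ x ≈ x
  x³≈x⇒σx≈x {x} x³≈x =
    [ [ fixed 0#-homo , fixed 1#-homo ∘ x∙y⁻¹≈ε⇒x≈y x 1# ]′ ∘ x*y≈0⇒x≈0⊎y≈0
    , fixed (trans (-‿homo 1#) (-‿cong 1#-homo)) ∘ +-inverseˡ-unique x 1#
    ]′ (x*y≈0⇒x≈0⊎y≈0 x[x-1][x+1]≈0)
    where
    x[x-1][x+1]≈0 : x * (x - 1#) * (x + 1#) ≈ 0#
    x[x-1][x+1]≈0 = trans (solve 1 (λ x → x :* (x :- con 1) :* (x :+ con 1) := x P.³ :- x) refl x)
                          (x≈y⇒x∙y⁻¹≈ε x³≈x)
    fixed : ∀ {k} → σ k ≈ k → x ≈ k → σ x ≈ x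
    fixed σk≈k x≈k = trans (⟦⟧-cong x≈k) (trans σk≈k (sym x≈k))

  x*x≈1⇒σx+x≉0 : ∀ {x} → x * x ≈ 1# → σ x + x ≉ 0#
  x*x≈1⇒σx+x≉0 {x} x²≈1 σx+x≈0 = 0≉1 (begin
    0#        ≈⟨ zeroˡ 0# ⟨
    0# * 0#   ≈⟨ *-cong x≈0 x≈0 ⟨
    x * x     ≈⟨ x²≈1 ⟩
    1#        ∎)
    where
    σx≈x : σ x ≈ x
    σx≈x = x³≈x⇒σx≈x (x∙y⁻¹≈ε⇒x≈y _ _ (vanishes₁
      (solve 1 (λ x → x P.³ :- x := x :* (x :* x :- con 1)) refl x) (x≈y⇒x∙y⁻¹≈ε x²≈1)))
    x≈0 : x ≈ 0#
    x≈0 = vanishes₁ (solve 1 (λ x → x := (con 1 :+ con 1) :* (x :+ x)) refl x)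
                    (trans (+-congʳ (sym σx≈x)) σx+x≈0)

  L≈0⇒t≈1 : ∀ {t T} → T ≈ σ t → L t T ≈ 0# → t ≈ 1#
  L≈0⇒t≈1 {t} {T} T≈σt L≈0 = x∙y⁻¹≈ε⇒x≈y t 1# (vanishes₂
    (solve 2 (λ t T → t :- con 1 := (:- con 1) :* P.u t T :+ con 1 :* (T :- t)) refl t T)
    (proj₂ t³≈t∧u≈0) (x≈y⇒x∙y⁻¹≈ε T≈t))
    where
    σ[t,T]≈[T,t³] : ∀ i → σ (lookup (t ∷ T ∷ []) i) ≈ lookup (T ∷ t ³ ∷ []) i
    σ[t,T]≈[T,t³] 0F = sym T≈σt
    σ[t,T]≈[T,t³] 1F = trans (⟦⟧-cong T≈σt) (σ∘σ≈cube t)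

    u≈0⇒t³≈t : u t T ≈ 0# → t ³ ≈ t
    u≈0⇒t³≈t u≈0 = x∙y⁻¹≈ε⇒x≈y _ _ (vanishes₂
      (solve 2 (λ t T → t P.³ :- t := con 1 :* P.u T (t P.³) :+ (:- con 1) :* P.u t T) refl t T)
      (σ-root (P.u (var 0F) (var 1F)) (t ∷ T ∷ []) (T ∷ t ³ ∷ []) σ[t,T]≈[T,t³] u≈0) u≈0)

    v≈0⇒t³≈t : v t T ≈ 0# → t ³ ≈ t
    v≈0⇒t³≈t v≈0 = x∙y⁻¹≈ε⇒x≈y _ _ (x³≈0⇒x≈0 (vanishes₂
      (solve 2 (λ t T → (t P.³ :- t) P.³ := (P.v t T :* P.v t T) :* P.v t T :+ (:- con 1) :* P.v T (t P.³))
             refl t T)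
      v≈0 (σ-root (P.v (var 0F) (var 1F)) (t ∷ T ∷ []) (T ∷ t ³ ∷ []) σ[t,T]≈[T,t³] v≈0)))

    t³≈t∧u≈0 : t ³ ≈ t × u t T ≈ 0#
    t³≈t∧u≈0 = [ (λ v≈0 → let t³≈t = v≈0⇒t³≈t v≈0 in t³≈t , trans (+-congʳ (+-congʳ (sym t³≈t))) v≈0)
               , (λ u³≈0 → let u≈0 = x³≈0⇒x≈0 u³≈0 in u≈0⇒t³≈t u≈0 , u≈0)
               ]′ (x*y≈0⇒x≈0⊎y≈0 L≈0)

    T≈t : T ≈ t
    T≈t = trans T≈σt (x³≈x⇒σx≈x (proj₁ t³≈t∧u≈0))

  -- Eliminating b from q = 0, r = 0 and σ(q) = 0 yields L t T = 0, so t = T = 1 and σ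
  -- negates the square root b − t of 1.
  Q≈0⇒q≉0 : ∀ {t T b B} → T ≈ σ t → B ≈ σ b → Q t T b B ≈ 0# → q t T b ≉ 0#
  Q≈0⇒q≉0 {t} {T} {b} {B} T≈σt B≈σb Q≈0 q≈0 = x*x≈1⇒σx+x≉0 [b-t]²≈1 σ[b-t]+[b-t]≈0
    where
    q[T,t³,B]≈0 : q T (t ³) B ≈ 0#
    q[T,t³,B]≈0 = σ-root (P.q (var 0F) (var 1F) (var 2F)) (t ∷ T ∷ b ∷ []) (T ∷ t ³ ∷ B ∷ [])
      (λ { 0F → sym T≈σt ; 1F → trans (⟦⟧-cong T≈σt) (σ∘σ≈cube t) ; 2F → sym B≈σb }) q≈0

    r≈0 : r t T b B ≈ 0#
    r≈0 = vanishes₂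
      (solve 4 (λ t T b B → P.r t T b B := con 1 :* P.Q t T b B :+ con 1 :* P.q t T b) refl t T b B)
      Q≈0 q≈0

    E≈0 : E t T b ≈ 0#
    E≈0 = vanishes₃
      (solve 4 (λ t T b B → P.E t T b
                 := con 1 :* P.q T (t P.³) B
                 :+ (:- (B :- con 1 :- t :* (b :- t))) :* P.r t T b B
                 :+ (:- (t :* t)) :* P.q t T b) refl t T b B)
      q[T,t³,B]≈0 r≈0 q≈0

    t≈1 : t ≈ 1#
    t≈1 = L≈0⇒t≈1 T≈σt (vanishes₂
      (solve 3 (λ t T b → P.L t T
                 := (t :* t :* (T :- con 1) :* (T :- con 1)) :* P.q t T b
                 :+ (P.E t T b :- (con 1 :+ con 1) :* t :* (T :- con 1) :* (b :- t)) :* P.E t T b)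
             refl t T b)
      q≈0 E≈0)

    t-1≈0 : t - 1# ≈ 0#
    t-1≈0 = x≈y⇒x∙y⁻¹≈ε t≈1

    T-1≈0 : T - 1# ≈ 0#
    T-1≈0 = x≈y⇒x∙y⁻¹≈ε (trans T≈σt (trans (⟦⟧-cong t≈1) 1#-homo))

    [b-t]²≈1 : (b - t) * (b - t) ≈ 1#
    [b-t]²≈1 = x∙y⁻¹≈ε⇒x≈y _ _ (vanishes₃
      (solve 3 (λ t T b → (b :- t) :* (b :- t) :- con 1
                 := con 1 :* P.q t T b :+ (:- (T :+ con 1)) :* (t :- con 1) :+ (:- con 1) :* (T :- con 1))
             refl t T b)
      q≈0 t-1≈0 T-1≈0)

    σ[b-t]+[b-t]≈0 : σ (b - t) + (b - t) ≈ 0#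
    σ[b-t]+[b-t]≈0 = trans
      (+-congʳ (σ-⟦ var 0F :- var 1F ⟧ (b ∷ t ∷ []) (B ∷ T ∷ []) λ { 0F → sym B≈σb ; 1F → sym T≈σt }))
      (vanishes₃
        (solve 4 (λ t T b B → B :- T :+ (b :- t)
                   := con 1 :* P.r t T b B :+ con 1 :* (T :- con 1) :+ (:- (b :- t)) :* (t :- con 1))
               refl t T b B)
        r≈0 T-1≈0 t-1≈0)

  -- The substitution t ↦ - t - 1 fixes Q, so the second factor reduces to the first.
  Q≉0 : ∀ {t T b B} → T ≈ σ t → B ≈ σ b → Q t T b B ≉ 0#
  Q≉0 {t} {T} {b} {B} T≈σt B≈σb Q≈0 =
    [ Q≈0⇒q≉0 T≈σt B≈σb Q≈0 , Q≈0⇒q≉0 -T-1≈σ[-t-1] B≈σb Q[-t-1,-T-1]≈0 ]′ (x*y≈0⇒x≈0⊎y≈0 q*q̃≈0)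
    where
    Q[T,t³,B,b³]≈0 : Q T (t ³) B (b ³) ≈ 0#
    Q[T,t³,B,b³]≈0 = σ-root (P.Q (var 0F) (var 1F) (var 2F) (var 3F))
      (t ∷ T ∷ b ∷ B ∷ []) (T ∷ t ³ ∷ B ∷ b ³ ∷ [])
      (λ { 0F → sym T≈σt ; 1F → trans (⟦⟧-cong T≈σt) (σ∘σ≈cube t)
         ; 2F → sym B≈σb ; 3F → trans (⟦⟧-cong B≈σb) (σ∘σ≈cube b) })
      Q≈0

    q*q̃≈0 : q t T b * q (- t - 1#) (- T - 1#) b ≈ 0#
    q*q̃≈0 = vanishes₂
      (solve 4 (λ t T b B → P.q t T b :* P.q (:- t :- con 1) (:- T :- con 1) b
                 := (con 1 :+ con 1) :* P.Q T (t P.³) B (b P.³)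
                 :+ (:- (b :* b :+ (T :* (t :- con 1) :- (t :+ con 1) :* (t :+ con 1)) :+ B)) :* P.Q t T b B)
             refl t T b B)
      Q[T,t³,B,b³]≈0 Q≈0

    -T-1≈σ[-t-1] : - T - 1# ≈ σ (- t - 1#)
    -T-1≈σ[-t-1] = sym (σ-⟦ :- var 0F :- con 1 ⟧ (t ∷ []) (T ∷ []) λ { 0F → sym T≈σt })

    Q[-t-1,-T-1]≈0 : Q (- t - 1#) (- T - 1#) b B ≈ 0#
    Q[-t-1,-T-1]≈0 = trans
      (solve 4 (λ t T b B → P.Q (:- t :- con 1) (:- T :- con 1) b B := P.Q t T b B) refl t T b B)
      Q≈0

  f : Carrier → Carrier → Carrier
  f a x = G x (σ x) a (σ a)

  G-cong : ∀ {x x′ X X′ a a′ A A′} → x ≈ x′ → X ≈ X′ → a ≈ a′ → A ≈ A′ → G x X a A ≈ G x′ X′ a′ A′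
  G-cong x≈ X≈ a≈ A≈ =
    +-cong (+-cong (*-cong (*-cong X≈ X≈) (*-cong (*-cong x≈ x≈) x≈)) (*-cong A≈ X≈))
           (-‿cong (*-cong (*-cong a≈ a≈) x≈))

  f-cong : ∀ {a a′ x x′} → a ≈ a′ → x ≈ x′ → f a x ≈ f a′ x′
  f-cong a≈a′ x≈x′ = G-cong x≈x′ (⟦⟧-cong x≈x′) a≈a′ (⟦⟧-cong a≈a′)

  f-odd : ∀ a x → f a (- x) ≈ - f a x
  f-odd a x = trans (G-cong refl (-‿homo x) refl refl)
    (solve 4 (λ x X a A → P.G (:- x) (:- X) a A := :- P.G x X a A) refl x (σ x) a (σ a))

  f-scaled-difference : ∀ b t d →
    f (b * d * σ d) (t * d + d) - f (b * d * σ d) (t * d) ≈ σ d * σ d * d ³ * Q (σ t) (t ³) b (σ b)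
  f-scaled-difference b t d = trans
    (+-cong (G-cong refl σ[td+d] refl σ[bdσd]) (-‿cong (G-cong refl (*-homo t d) refl σ[bdσd])))
    (solve 6 (λ t d b T D B →
        P.G (t :* d :+ d) (T :* D :+ D) (b :* d :* D) (B :* D :* d P.³)
          :- P.G (t :* d) (T :* D) (b :* d :* D) (B :* D :* d P.³)
        := D :* D :* d P.³ :* P.Q T (t P.³) b B)
      refl t d b (σ t) (σ d) (σ b))
    where
    σ[td+d] : σ (t * d + d) ≈ σ t * σ d + σ d
    σ[td+d] = trans (+-homo _ _) (+-congʳ (*-homo t d))
    σ[bdσd] : σ (b * d * σ d) ≈ σ b * σ d * d ³
    σ[bdσd] = trans (*-homo _ _) (*-cong (*-homo b d) (σ∘σ≈cube d))

  f-injective : ∀ a {x y} → f a x ≈ f a y → x ≈ y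
  f-injective a {x} {y} fx≈fy with x ≟ y
  ... | yes x≈y = x≈y
  ... | no  x≉y = contradiction Q≈0 (Q≉0 (sym (σ∘σ≈cube t)) refl)
    where
    d = y - x
    d≉0 : d ≉ 0#
    d≉0 d≈0 = x≉y (sym (x∙y⁻¹≈ε⇒x≈y y x d≈0))
    σd≉0 : σ d ≉ 0#
    σd≉0 σd≈0 = d≉0 (x³≈0⇒x≈0 (trans (sym (σ∘σ≈cube d)) (trans (⟦⟧-cong σd≈0) 0#-homo)))
    d⁻¹ = proj₁ (inverse d d≉0)
    dd⁻¹≈1 : d * d⁻¹ ≈ 1#
    dd⁻¹≈1 = proj₂ (inverse d d≉0)
    σd⁻¹ = proj₁ (inverse (σ d) σd≉0)
    σdσd⁻¹≈1 : σ d * σd⁻¹ ≈ 1#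
    σdσd⁻¹≈1 = proj₂ (inverse (σ d) σd≉0)

    t = x * d⁻¹
    b = a * (d⁻¹ * σd⁻¹)

    x≈td : x ≈ t * d
    x≈td = sym (begin
      x * d⁻¹ * d    ≈⟨ solve 3 (λ x d e → x :* e :* d := x :* (d :* e)) refl x d d⁻¹ ⟩
      x * (d * d⁻¹)  ≈⟨ *-congˡ dd⁻¹≈1 ⟩
      x * 1#         ≈⟨ *-identityʳ x ⟩
      x              ∎)
    y≈td+d : y ≈ t * d + d
    y≈td+d = trans (solve 2 (λ x y → y := x :+ (y :- x)) refl x y) (+-congʳ x≈td)
    a≈bdσd : a ≈ b * d * σ d
    a≈bdσd = sym (begin
      a * (d⁻¹ * σd⁻¹) * d * σ d
        ≈⟨ solve 5 (λ a d D e E → a :* (e :* E) :* d :* D := a :* (d :* e) :* (D :* E)) refl a d (σ d) d⁻¹ σd⁻¹ ⟩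
      a * (d * d⁻¹) * (σ d * σd⁻¹)  ≈⟨ *-cong (*-congˡ dd⁻¹≈1) σdσd⁻¹≈1 ⟩
      a * 1# * 1#                    ≈⟨ trans (*-identityʳ _) (*-identityʳ a) ⟩
      a                              ∎)

    scaled-difference≈0 : f (b * d * σ d) (t * d + d) - f (b * d * σ d) (t * d) ≈ 0#
    scaled-difference≈0 = x≈y⇒x∙y⁻¹≈ε (begin
      f (b * d * σ d) (t * d + d)  ≈⟨ f-cong a≈bdσd y≈td+d ⟨
      f a y                        ≈⟨ fx≈fy ⟨
      f a x                        ≈⟨ f-cong a≈bdσd x≈td ⟩
      f (b * d * σ d) (t * d)      ∎)

    σd²d³≉0 : σ d * σ d * d ³ ≉ 0#
    σd²d³≉0 = x≉0∧y≉0⇒x*y≉0 (x≉0∧y≉0⇒x*y≉0 σd≉0 σd≉0) (x≉0∧y≉0⇒x*y≉0 (x≉0∧y≉0⇒x*y≉0 d≉0 d≉0) d≉0)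

    Q≈0 : Q (σ t) (t ³) b (σ b) ≈ 0#
    Q≈0 = [ ⊥-elim ∘ σd²d³≉0 , id ]′
      (x*y≈0⇒x≈0⊎y≈0 (trans (sym (f-scaled-difference b t d)) scaled-difference≈0))

Fin-injective⇒surjective : ∀ {m} {g : Fin m → Fin m} → Injective _≡_ _≡_ g → ∀ j → ∃ λ i → g i ≡ j
Fin-injective⇒surjective {ℕ.suc m} {g} g-injective j with Fin.any? (λ i → g i Fin.≟ j)
... | yes gi≡j = gi≡j
... | no  ∄gi≡j = contradiction (Fin.injective⇒≤ punchOut∘g-injective) ℕ.1+n≰n
  where
  gi≢j : ∀ i → j ≢ g i
  gi≢j i j≡gi = ∄gi≡j (i , ≡.sym j≡gi)
  punchOut∘g-injective : Injective _≡_ _≡_ (λ i → punchOut (gi≢j i))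
  punchOut∘g-injective = g-injective ∘ Fin.punchOut-injective (gi≢j _) (gi≢j _)

module FiniteField {c ℓ : Level} {F : CommutativeRing c ℓ} {n : ℕ}
  (isFiniteField : IsFiniteField F (ℕ.suc n)) where
  open CommutativeRing F
  open import Algebra.Properties.Ring ring using (+-identityʳ-unique; //-rightDividesˡ; //-rightDividesʳ)
  open import Algebra.Properties.Semiring.Exp semiring using (_^_)
  import Algebra.Definitions.RawMonoid +-rawMonoid as Mult
  open import Relation.Binary.Reasoning.Setoid setoid

  private
    module Count = Bijection (IsFiniteField.count isFiniteField)
    module Enumeration = Inverse (Bijection⇒Inverse (IsFiniteField.count isFiniteField))

  index : Carrier → Fin (ℕ.suc n)
  index = Count.to

  element : Fin (ℕ.suc n) → Carrier
  element = Enumeration.from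

  element-index : ∀ x → element (index x) ≈ x
  element-index = Enumeration.strictlyInverseʳ

  index-element : ∀ i → index (element i) ≡ i
  index-element = Enumeration.strictlyInverseˡ

  infix 4 _≟_
  _≟_ : Decidable _≈_
  x ≟ y = Dec.map′ Count.injective Count.cong (index x Fin.≟ index y)

  isDiscreteField : IsDiscreteField F
  isDiscreteField = record
    { 0≉1 = IsFiniteField.0≉1 isFiniteField
    ; inverse = IsFiniteField.inverse isFiniteField
    ; _≟_ = _≟_
    }

  open DiscreteField isDiscreteField public hiding (_≟_)

  module _ {m ℓm : Level} (M : CommutativeMonoid m ℓm) where
    open CommutativeMonoid M using () renaming (Carrier to A; _≈_ to _≈ᴹ_; trans to transᴹ)
    open import Algebra.Properties.CommutativeMonoid.Sum M using (sum; sum-permute; sum-cong-≋)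

    sum-invariant : ∀ {t : Carrier → A} → Congruent _≈_ _≈ᴹ_ t →
                    ∀ {φ ψ} → Congruent _≈_ _≈_ φ → Congruent _≈_ _≈_ ψ →
                    StrictlyInverseˡ _≈_ φ ψ → StrictlyInverseʳ _≈_ φ ψ →
                    sum (t ∘ element) ≈ᴹ sum (t ∘ φ ∘ element)
    sum-invariant {t} t-cong {φ} {ψ} φ-cong ψ-cong φ∘ψ≈id ψ∘φ≈id =
      transᴹ (sum-permute (t ∘ element) π) (sum-cong-≋ (λ i → t-cong (element-index (φ (element i)))))
      where
      conjugate : ∀ {φ ψ} → Congruent _≈_ _≈_ φ → StrictlyInverseˡ _≈_ φ ψ →
                  StrictlyInverseˡ _≡_ (index ∘ φ ∘ element) (index ∘ ψ ∘ element)
      conjugate φ-cong φ∘ψ≈id i =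
        ≡.trans (Count.cong (trans (φ-cong (element-index _)) (φ∘ψ≈id (element i)))) (index-element i)
      π = permutation (index ∘ φ ∘ element) (index ∘ ψ ∘ element)
                      (conjugate φ-cong φ∘ψ≈id) (conjugate ψ-cong ψ∘φ≈id)

  open import Algebra.Properties.CommutativeMonoid.Sum +-commutativeMonoid
    using (∑-distrib-+; sum-replicate) renaming (sum to ∑)
  open import Algebra.Properties.CommutativeMonoid.Sum *-commutativeMonoid
    using (sum-remove)
    renaming (sum to ∏; sum-cong-≋ to ∏-cong-≋; ∑-distrib-+ to ∏-distrib-*; sum-replicate to ∏-replicate)

  [1+n]×1≈0 : ℕ.suc n Mult.× 1# ≈ 0#
  [1+n]×1≈0 = +-identityʳ-unique (∑ element) _ (sym (begin
    ∑ element                             ≈⟨ sum-invariant +-commutativeMonoid id +-congʳ +-congʳ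
                                                 (//-rightDividesˡ 1#) (//-rightDividesʳ 1#) ⟩
    ∑ (λ i → element i + 1#)              ≈⟨ ∑-distrib-+ element (λ _ → 1#) ⟩
    ∑ element + ∑ {ℕ.suc n} (λ _ → 1#)    ≈⟨ +-congˡ (sum-replicate (ℕ.suc n) {1#}) ⟩
    ∑ element + ℕ.suc n Mult.× 1#         ∎))

  -- Products of zeroToOne over all of F, which are invariant under permutations of F,
  -- stand in for products over the nonzero elements.
  zeroToOne : Carrier → Carrier
  zeroToOne x with x ≟ 0#
  ... | yes _ = 1#
  ... | no  _ = x

  zeroToOne-zero : ∀ {x} → x ≈ 0# → zeroToOne x ≈ 1#
  zeroToOne-zero {x} x≈0 with x ≟ 0#
  ... | yes _   = refl
  ... | no  x≉0 = contradiction x≈0 x≉0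

  zeroToOne-nonzero : ∀ {x} → x ≉ 0# → zeroToOne x ≈ x
  zeroToOne-nonzero {x} x≉0 with x ≟ 0#
  ... | yes x≈0 = contradiction x≈0 x≉0
  ... | no  _   = refl

  zeroToOne-cong : Congruent _≈_ _≈_ zeroToOne
  zeroToOne-cong {x} {y} x≈y =
    [ (λ x≈0 → trans (zeroToOne-zero x≈0) (sym (zeroToOne-zero (trans (sym x≈y) x≈0))))
    , (λ x≉0 → trans (zeroToOne-nonzero x≉0) (trans x≈y (sym (zeroToOne-nonzero (x≉0 ∘ trans x≈y)))))
    ]′ (Dec.toSum (x ≟ 0#))

  nonzero : Fin n → Carrier
  nonzero j = element (punchIn (index 0#) j)

  nonzero≉0 : ∀ j → nonzero j ≉ 0#
  nonzero≉0 j e≈0 = Fin.punchInᵢ≢i (index 0#) j (≡.trans (≡.sym (index-element _)) (Count.cong e≈0))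

  ∏-zeroToOne : ∀ {φ} → Congruent _≈_ _≈_ φ → φ 0# ≈ 0# → (∀ {x} → x ≉ 0# → φ x ≉ 0#) →
                ∏ (zeroToOne ∘ φ ∘ element) ≈ ∏ (φ ∘ nonzero)
  ∏-zeroToOne {φ} φ-cong φ0≈0 φ-nonzero = begin
    ∏ (zeroToOne ∘ φ ∘ element)
      ≈⟨ sum-remove {i = index 0#} (zeroToOne ∘ φ ∘ element) ⟩
    zeroToOne (φ (element (index 0#))) * ∏ (zeroToOne ∘ φ ∘ nonzero)
      ≈⟨ *-cong (zeroToOne-zero (trans (φ-cong (element-index 0#)) φ0≈0))
                (∏-cong-≋ (λ j → zeroToOne-nonzero (φ-nonzero (nonzero≉0 j)))) ⟩
    1# * ∏ (φ ∘ nonzero)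
      ≈⟨ *-identityˡ _ ⟩
    ∏ (φ ∘ nonzero)
      ∎

  x≉0⇒x^n≈1 : ∀ {x} → x ≉ 0# → x ^ n ≈ 1#
  x≉0⇒x^n≈1 {x} x≉0 = *-cancelˡ-nonZero P (x ^ n) 1# (∏≉0 nonzero nonzero≉0) (begin
    P * x ^ n                             ≈⟨ *-comm P _ ⟩
    x ^ n * P                             ≈⟨ *-congʳ (∏-replicate n {x}) ⟨
    ∏ {n} (λ _ → x) * P                   ≈⟨ ∏-distrib-* (λ _ → x) nonzero ⟨
    ∏ (λ j → x * nonzero j)               ≈⟨ ∏-zeroToOne *-congˡ (zeroʳ x) (x≉0∧y≉0⇒x*y≉0 x≉0) ⟨
    ∏ (zeroToOne ∘ (x *_) ∘ element)      ≈⟨ sum-invariant *-commutativeMonoid zeroToOne-cong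
                                                   *-congˡ *-congˡ x*[x⁻¹*y]≈y x⁻¹*[x*y]≈y ⟨
    ∏ (zeroToOne ∘ element)               ≈⟨ ∏-zeroToOne id refl id ⟩
    P                                     ≈⟨ *-identityʳ P ⟨
    P * 1#                                ∎)
    where
    P = ∏ nonzero
    x⁻¹ = proj₁ (inverse x x≉0)
    xx⁻¹≈1 : x * x⁻¹ ≈ 1#
    xx⁻¹≈1 = proj₂ (inverse x x≉0)
    x*[x⁻¹*y]≈y : ∀ y → x * (x⁻¹ * y) ≈ y
    x*[x⁻¹*y]≈y y = trans (sym (*-assoc x x⁻¹ y)) (trans (*-congʳ xx⁻¹≈1) (*-identityˡ y))
    x⁻¹*[x*y]≈y : ∀ y → x⁻¹ * (x * y) ≈ y
    x⁻¹*[x*y]≈y y =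
      trans (sym (*-assoc x⁻¹ x y)) (trans (*-congʳ (trans (*-comm x⁻¹ x) xx⁻¹≈1)) (*-identityˡ y))

  x^[1+n]≈x : ∀ x → x ^ ℕ.suc n ≈ x
  x^[1+n]≈x x with x ≟ 0#
  ... | yes x≈0 = trans (*-congʳ x≈0) (trans (zeroˡ _) (sym x≈0))
  ... | no  x≉0 = trans (*-congˡ (x≉0⇒x^n≈1 x≉0)) (*-identityʳ x)

  injective⇒surjective : ∀ {g : Carrier → Carrier} → Injective _≈_ _≈_ g → ∀ y → ∃ λ x → g x ≈ y
  injective⇒surjective {g} g-injective y =
    element (proj₁ preimage) , Count.injective (proj₂ preimage)
    where
    index∘g∘element-injective : Injective _≡_ _≡_ (index ∘ g ∘ element)
    index∘g∘element-injective {i} {j} gi≡gj =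
      ≡.trans (≡.sym (index-element i))
              (≡.trans (Count.cong (g-injective (Count.injective gi≡gj))) (index-element j))
    preimage : ∃ λ i → index (g (element i)) ≡ index y
    preimage = Fin-injective⇒surjective index∘g∘element-injective (index y)

module OrderThreeModFour {c ℓ : Level} {F : CommutativeRing c ℓ} {K : ℕ}
  (isFiniteField : IsFiniteField F (3 ℕ.+ 4 ℕ.* K)) where

  open CommutativeRing F
  open FiniteField isFiniteField
  open Powers F
  open import Algebra.Properties.Ring ring using (-‿distribˡ-*; -‿involutive; -0#≈0#)
  open import Algebra.Properties.Semiring.Exp semiring using (_^_; ^-congˡ; ^-assocʳ; ^-homo-*)
  open import Algebra.Properties.CommutativeSemiring.Exp commutativeSemiring using (^-distrib-*)
  open import Algebra.Properties.Semiring.Mult semiring using (×1-homo-*)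
  import Algebra.Definitions.RawMonoid +-rawMonoid as Mult
  open import Relation.Binary.Reasoning.Setoid setoid

  M : ℕ
  M = 1 ℕ.+ 2 ℕ.* K

  1+1≉0 : 1# + 1# ≉ 0#
  1+1≉0 1+1≈0 = 0≉1 (begin
    0#                                     ≈⟨ [1+n]×1≈0 ⟨
    (3 ℕ.+ 4 ℕ.* K) Mult.× 1#              ≡⟨ ≡.cong (Mult._× 1#) (3+4K≡1+2M K) ⟩
    1# + (2 ℕ.* M) Mult.× 1#               ≈⟨ +-congˡ (×1-homo-* 2 M) ⟩
    1# + (2 Mult.× 1#) * (M Mult.× 1#)     ≈⟨ +-congˡ (*-congʳ (trans (+-congˡ (+-identityʳ 1#)) 1+1≈0)) ⟩
    1# + 0# * (M Mult.× 1#)                ≈⟨ +-congˡ (zeroˡ _) ⟩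
    1# + 0#                                ≈⟨ +-identityʳ 1# ⟩
    1#                                     ∎)
    where
    3+4K≡1+2M : ∀ K → 3 ℕ.+ 4 ℕ.* K ≡ 1 ℕ.+ 2 ℕ.* (1 ℕ.+ 2 ℕ.* K)
    3+4K≡1+2M = solve-∀

  x+x≈0⇒x≈0 : ∀ {x} → x + x ≈ 0# → x ≈ 0#
  x+x≈0⇒x≈0 {x} x+x≈0 = [ ⊥-elim ∘ 1+1≉0 , id ]′ (x*y≈0⇒x≈0⊎y≈0 (begin
    (1# + 1#) * x    ≈⟨ distribʳ x 1# 1# ⟩
    1# * x + 1# * x  ≈⟨ +-cong (*-identityˡ x) (*-identityˡ x) ⟩
    x + x            ≈⟨ x+x≈0 ⟩
    0#               ∎))

  x≉0⇒x^M≈±1 : ∀ {x} → x ≉ 0# → x ^ M ≈ 1# ⊎ x ^ M ≈ - 1#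
  x≉0⇒x^M≈±1 {x} x≉0 = x*x≈1⇒x≈1⊎x≈-1 (begin
    x ^ M * x ^ M              ≈⟨ ^-homo-* x M M ⟨
    x ^ (M ℕ.+ M)              ≡⟨ ≡.cong (x ^_) (M+M≡2+4K K) ⟩
    x ^ (2 ℕ.+ 4 ℕ.* K)        ≈⟨ x≉0⇒x^n≈1 x≉0 ⟩
    1#                         ∎)
    where
    M+M≡2+4K : ∀ K → (1 ℕ.+ 2 ℕ.* K) ℕ.+ (1 ℕ.+ 2 ℕ.* K) ≡ 2 ℕ.+ 4 ℕ.* K
    M+M≡2+4K = solve-∀

  x^M≈1⇒x≈[x^[1+K]]^2 : ∀ {x} → x ^ M ≈ 1# → x ≈ (x ^ (1 ℕ.+ K)) ^ 2
  x^M≈1⇒x≈[x^[1+K]]^2 {x} x^M≈1 = sym (begin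
    (x ^ (1 ℕ.+ K)) ^ 2        ≈⟨ ^-assocʳ x (1 ℕ.+ K) 2 ⟩
    x ^ ((1 ℕ.+ K) ℕ.* 2)      ≡⟨ ≡.cong (x ^_) ([1+K]*2≡1+M K) ⟩
    x * x ^ M                  ≈⟨ *-congˡ x^M≈1 ⟩
    x * 1#                     ≈⟨ *-identityʳ x ⟩
    x                          ∎)
    where
    [1+K]*2≡1+M : ∀ K → (1 ℕ.+ K) ℕ.* 2 ≡ 1 ℕ.+ (1 ℕ.+ 2 ℕ.* K)
    [1+K]*2≡1+M = solve-∀

  -1-nonsquare : ∀ s → s ^ 2 ≉ - 1#
  -1-nonsquare s s²≈-1 = 1+1≉0 (begin
    1# + 1#    ≈⟨ +-congˡ -1≈1 ⟨
    1# + - 1#  ≈⟨ -‿inverseʳ 1# ⟩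
    0#         ∎)
    where
    s≉0 : s ≉ 0#
    s≉0 s≈0 = 0≉1 (sym (begin
      1#           ≈⟨ -‿involutive 1# ⟨
      - - 1#       ≈⟨ -‿cong s²≈-1 ⟨
      - (s ^ 2)    ≈⟨ -‿cong (trans (*-congʳ s≈0) (zeroˡ _)) ⟩
      - 0#         ≈⟨ -0#≈0# ⟩
      0#           ∎))
    -1≈1 : - 1# ≈ 1#
    -1≈1 = begin
      - 1#                   ≈⟨ -‿cong (1^n≈1 M) ⟨
      - (1# ^ M)             ≈⟨ [-x]^[1+2k]≈-[x^[1+2k]] 1# K ⟨
      (- 1#) ^ M             ≈⟨ ^-congˡ M s²≈-1 ⟨
      (s ^ 2) ^ M            ≈⟨ ^-assocʳ s 2 M ⟩
      s ^ (2 ℕ.* M)          ≡⟨ ≡.cong (s ^_) (2M≡2+4K K) ⟩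
      s ^ (2 ℕ.+ 4 ℕ.* K)    ≈⟨ x≉0⇒x^n≈1 s≉0 ⟩
      1#                     ∎
      where
      2M≡2+4K : ∀ K → 2 ℕ.* (1 ℕ.+ 2 ℕ.* K) ≡ 2 ℕ.+ 4 ℕ.* K
      2M≡2+4K = solve-∀

  IsNonzeroSquare : Carrier → Set (c ⊔ ℓ)
  IsNonzeroSquare x = ∃ λ s → s ≉ 0# × x ≈ s ^ 2

  x≉0⇒square⊎-square : ∀ {x} → x ≉ 0# → IsNonzeroSquare x ⊎ IsNonzeroSquare (- x)
  x≉0⇒square⊎-square {x} x≉0 =
    [ inj₁ ∘ square x≉0 , inj₂ ∘ square -x≉0 ∘ [-x]^M≈1 ]′ (x≉0⇒x^M≈±1 x≉0)
    where
    square : ∀ {y} → y ≉ 0# → y ^ M ≈ 1# → IsNonzeroSquare y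
    square {y} y≉0 y^M≈1 = y ^ (1 ℕ.+ K) , y≉0 ∘ x^n≈0⇒x≈0 (1 ℕ.+ K) , x^M≈1⇒x≈[x^[1+K]]^2 y^M≈1
    -x≉0 : - x ≉ 0#
    -x≉0 -x≈0 = x≉0 (trans (sym (-‿involutive x)) (trans (-‿cong -x≈0) -0#≈0#))
    [-x]^M≈1 : x ^ M ≈ - 1# → (- x) ^ M ≈ 1#
    [-x]^M≈1 x^M≈-1 = trans ([-x]^[1+2k]≈-[x^[1+2k]] x K) (trans (-‿cong x^M≈-1) (-‿involutive 1#))

  module Partition {g : Carrier → Carrier} (g-cong : Congruent _≈_ _≈_ g)
                   (g-injective : Injective _≈_ _≈_ g) (g-odd : ∀ x → g (- x) ≈ - g x) where

    ImageOfNonzeroSquares : Carrier → Set (c ⊔ ℓ)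
    ImageOfNonzeroSquares y = ∃ λ x → x ≉ 0# × y ≈ g (x ^ 2)

    g0≈0 : g 0# ≈ 0#
    g0≈0 = x+x≈0⇒x≈0 (trans (+-congˡ (trans (g-cong (sym -0#≈0#)) (g-odd 0#))) (-‿inverseʳ _))

    image-disjoint : ∀ y → ¬ (ImageOfNonzeroSquares y × ImageOfNonzeroSquares (- y))
    image-disjoint y ((x , x≉0 , y≈gx²) , (x′ , _ , -y≈gx′²)) = -1-nonsquare (x′ * x⁻¹) (begin
      (x′ * x⁻¹) ^ 2          ≈⟨ ^-distrib-* x′ x⁻¹ 2 ⟩
      x′ ^ 2 * x⁻¹ ^ 2        ≈⟨ *-congʳ x′²≈-x² ⟩
      - (x ^ 2) * x⁻¹ ^ 2     ≈⟨ -‿distribˡ-* _ _ ⟨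
      - (x ^ 2 * x⁻¹ ^ 2)     ≈⟨ -‿cong (^-distrib-* x x⁻¹ 2) ⟨
      - ((x * x⁻¹) ^ 2)       ≈⟨ -‿cong (trans (^-congˡ 2 (proj₂ (inverse x x≉0))) (1^n≈1 2)) ⟩
      - 1#                    ∎)
      where
      x⁻¹ = proj₁ (inverse x x≉0)
      x′²≈-x² : x′ ^ 2 ≈ - (x ^ 2)
      x′²≈-x² = g-injective (begin
        g (x′ ^ 2)     ≈⟨ -y≈gx′² ⟨
        - y            ≈⟨ -‿cong y≈gx² ⟩
        - g (x ^ 2)    ≈⟨ g-odd _ ⟨
        g (- (x ^ 2))  ∎)

    image-covers : ∀ y → ImageOfNonzeroSquares y ⊎ ImageOfNonzeroSquares (- y) ⊎ y ≈ 0#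
    image-covers y with y ≟ 0#
    ... | yes y≈0 = inj₂ (inj₂ y≈0)
    ... | no  y≉0 = [ inj₁ ∘ fromSquare , inj₂ ∘ inj₁ ∘ fromNegatedSquare ]′ (x≉0⇒square⊎-square z≉0)
      where
      z = proj₁ (injective⇒surjective g-injective y)
      gz≈y : g z ≈ y
      gz≈y = proj₂ (injective⇒surjective g-injective y)
      z≉0 : z ≉ 0#
      z≉0 z≈0 = y≉0 (trans (sym gz≈y) (trans (g-cong z≈0) g0≈0))
      fromSquare : IsNonzeroSquare z → ImageOfNonzeroSquares y
      fromSquare (s , s≉0 , z≈s²) = s , s≉0 , trans (sym gz≈y) (g-cong z≈s²)
      fromNegatedSquare : IsNonzeroSquare (- z) → ImageOfNonzeroSquares (- y)
      fromNegatedSquare (s , s≉0 , -z≈s²) = s , s≉0 , (begin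
        - y        ≈⟨ -‿cong gz≈y ⟨
        - g z      ≈⟨ g-odd z ⟨
        g (- z)    ≈⟨ g-cong -z≈s² ⟩
        g (s ^ 2)  ∎)

3^[2h+1]≡3+4K : ∀ h → ∃ λ K → 3 ℕ.^ (2 ℕ.* h ℕ.+ 1) ≡ 3 ℕ.+ 4 ℕ.* K
3^[2h+1]≡3+4K ℕ.zero    = 0 , ≡.refl
3^[2h+1]≡3+4K (ℕ.suc h) = 6 ℕ.+ 9 ℕ.* K , (begin
  3 ℕ.^ (2 ℕ.* ℕ.suc h ℕ.+ 1)      ≡⟨ ≡.cong (3 ℕ.^_) (exponent h) ⟩
  3 ℕ.^ ((2 ℕ.* h ℕ.+ 1) ℕ.+ 2)    ≡⟨ ℕ.^-distribˡ-+-* 3 (2 ℕ.* h ℕ.+ 1) 2 ⟩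
  3 ℕ.^ (2 ℕ.* h ℕ.+ 1) ℕ.* 9      ≡⟨ ≡.cong (ℕ._* 9) q≡3+4K ⟩
  (3 ℕ.+ 4 ℕ.* K) ℕ.* 9            ≡⟨ multiple K ⟩
  3 ℕ.+ 4 ℕ.* (6 ℕ.+ 9 ℕ.* K)      ∎)
  where
  open ≡.≡-Reasoning
  K = proj₁ (3^[2h+1]≡3+4K h)
  q≡3+4K = proj₂ (3^[2h+1]≡3+4K h)
  exponent : ∀ h → 2 ℕ.* ℕ.suc h ℕ.+ 1 ≡ (2 ℕ.* h ℕ.+ 1) ℕ.+ 2
  exponent = solve-∀
  multiple : ∀ K → (3 ℕ.+ 4 ℕ.* K) ℕ.* 9 ≡ 3 ℕ.+ 4 ℕ.* (6 ℕ.+ 9 ℕ.* K)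
  multiple = solve-∀

3^[h+1]*3^[h+1]≡3^[2h+1]*3 : ∀ h → 3 ℕ.^ (h ℕ.+ 1) ℕ.* 3 ℕ.^ (h ℕ.+ 1) ≡ 3 ℕ.^ (2 ℕ.* h ℕ.+ 1) ℕ.* 3
3^[h+1]*3^[h+1]≡3^[2h+1]*3 h = begin
  3 ℕ.^ (h ℕ.+ 1) ℕ.* 3 ℕ.^ (h ℕ.+ 1)  ≡⟨ ℕ.^-distribˡ-+-* 3 (h ℕ.+ 1) (h ℕ.+ 1) ⟨
  3 ℕ.^ ((h ℕ.+ 1) ℕ.+ (h ℕ.+ 1))      ≡⟨ ≡.cong (3 ℕ.^_) (exponent h) ⟩
  3 ℕ.^ ((2 ℕ.* h ℕ.+ 1) ℕ.+ 1)        ≡⟨ ℕ.^-distribˡ-+-* 3 (2 ℕ.* h ℕ.+ 1) 1 ⟩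
  3 ℕ.^ (2 ℕ.* h ℕ.+ 1) ℕ.* 3          ∎
  where
  open ≡.≡-Reasoning
  exponent : ∀ h → (h ℕ.+ 1) ℕ.+ (h ℕ.+ 1) ≡ (2 ℕ.* h ℕ.+ 1) ℕ.+ 1
  exponent = solve-∀

module PowersOfThree (h : ℕ) {c ℓ : Level} {F : CommutativeRing c ℓ}
  (isFiniteField : IsFiniteField F (3 ℕ.^ (2 ℕ.* h ℕ.+ 1))) where

  open CommutativeRing F
  open Powers F
  open import Algebra.Properties.Semiring.Exp semiring using (_^_; ^-congˡ; ^-congʳ; ^-assocʳ; ^-homo-*)
  open import Algebra.Properties.CommutativeSemiring.Exp commutativeSemiring using (^-distrib-*)
  open import Algebra.Properties.Semiring.Mult semiring using (×1-homo-*)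
  import Algebra.Definitions.RawMonoid +-rawMonoid as Mult
  open import Relation.Binary.Reasoning.Setoid setoid

  α : ℕ
  α = 3 ℕ.^ (h ℕ.+ 1)

  K : ℕ
  K = proj₁ (3^[2h+1]≡3+4K h)

  isFiniteField′ : IsFiniteField F (3 ℕ.+ 4 ℕ.* K)
  isFiniteField′ = ≡.subst (IsFiniteField F) (proj₂ (3^[2h+1]≡3+4K h)) isFiniteField

  open FiniteField isFiniteField′ using (isDiscreteField; [1+n]×1≈0; x^[1+n]≈x; x^n≈0⇒x≈0)

  char3 : HasCharacteristicThree F
  char3 = begin
    1# + 1# + 1#              ≈⟨ +-assoc 1# 1# 1# ⟩
    1# + (1# + 1#)            ≈⟨ +-congˡ (+-congˡ (+-identityʳ 1#)) ⟨
    3 Mult.× 1#               ≈⟨ x^n≈0⇒x≈0 (2 ℕ.* h ℕ.+ 1) [3×1]^[2h+1]≈0 ⟩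
    0#                        ∎
    where
    3^k×1≈[3×1]^k : ∀ k → (3 ℕ.^ k) Mult.× 1# ≈ (3 Mult.× 1#) ^ k
    3^k×1≈[3×1]^k ℕ.zero    = +-identityʳ 1#
    3^k×1≈[3×1]^k (ℕ.suc k) = trans (×1-homo-* 3 (3 ℕ.^ k)) (*-congˡ (3^k×1≈[3×1]^k k))
    [3×1]^[2h+1]≈0 : (3 Mult.× 1#) ^ (2 ℕ.* h ℕ.+ 1) ≈ 0#
    [3×1]^[2h+1]≈0 = begin
      (3 Mult.× 1#) ^ (2 ℕ.* h ℕ.+ 1)   ≈⟨ 3^k×1≈[3×1]^k (2 ℕ.* h ℕ.+ 1) ⟨
      (3 ℕ.^ (2 ℕ.* h ℕ.+ 1)) Mult.× 1# ≡⟨ ≡.cong (Mult._× 1#) (proj₂ (3^[2h+1]≡3+4K h)) ⟩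
      (3 ℕ.+ 4 ℕ.* K) Mult.× 1#         ≈⟨ [1+n]×1≈0 ⟩
      0#                                ∎

  open CharacteristicThree F char3 using (solve; _:=_; _:+_; _:^_)

  x^3≈x*x*x : ∀ x → x ^ 3 ≈ x * x * x
  x^3≈x*x*x x = trans (*-congˡ (*-congˡ (*-identityʳ x))) (sym (*-assoc x x x))

  [x+y]^3≈x^3+y^3 : ∀ x y → (x + y) ^ 3 ≈ x ^ 3 + y ^ 3
  [x+y]^3≈x^3+y^3 = solve 2 (λ x y → (x :+ y) :^ 3 := x :^ 3 :+ y :^ 3) refl

  [x+y]^3^k≈x^3^k+y^3^k : ∀ k x y → (x + y) ^ (3 ℕ.^ k) ≈ x ^ (3 ℕ.^ k) + y ^ (3 ℕ.^ k)
  [x+y]^3^k≈x^3^k+y^3^k ℕ.zero    x y =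
    trans (*-identityʳ _) (sym (+-cong (*-identityʳ x) (*-identityʳ y)))
  [x+y]^3^k≈x^3^k+y^3^k (ℕ.suc k) x y = begin
    (x + y) ^ (3 ℕ.* 3 ℕ.^ k)                  ≈⟨ ^-assocʳ (x + y) 3 (3 ℕ.^ k) ⟨
    ((x + y) ^ 3) ^ 3 ℕ.^ k                    ≈⟨ ^-congˡ (3 ℕ.^ k) ([x+y]^3≈x^3+y^3 x y) ⟩
    (x ^ 3 + y ^ 3) ^ 3 ℕ.^ k                  ≈⟨ [x+y]^3^k≈x^3^k+y^3^k k (x ^ 3) (y ^ 3) ⟩
    (x ^ 3) ^ 3 ℕ.^ k + (y ^ 3) ^ 3 ℕ.^ k      ≈⟨ +-cong (^-assocʳ x 3 (3 ℕ.^ k)) (^-assocʳ y 3 (3 ℕ.^ k)) ⟩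
    x ^ (3 ℕ.* 3 ℕ.^ k) + y ^ (3 ℕ.* 3 ℕ.^ k)  ∎

  σ : Carrier → Carrier
  σ x = x ^ α

  isSquareRootOfFrobenius : IsSquareRootOfFrobenius F σ
  isSquareRootOfFrobenius = record
    { isRingHomomorphism = +-*-1#-homo⇒isRingHomomorphism F
        (^-congˡ α) ([x+y]^3^k≈x^3^k+y^3^k (h ℕ.+ 1)) (λ x y → ^-distrib-* x y α) (1^n≈1 α)
    ; σ∘σ≈cube = λ x → begin
        (x ^ α) ^ α                          ≈⟨ ^-assocʳ x α α ⟩
        x ^ (α ℕ.* α)                        ≡⟨ ≡.cong (x ^_) (3^[h+1]*3^[h+1]≡3^[2h+1]*3 h) ⟩
        x ^ (3 ℕ.^ (2 ℕ.* h ℕ.+ 1) ℕ.* 3)    ≡⟨ ≡.cong (λ q → x ^ (q ℕ.* 3)) (proj₂ (3^[2h+1]≡3+4K h)) ⟩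
        x ^ ((3 ℕ.+ 4 ℕ.* K) ℕ.* 3)          ≈⟨ ^-assocʳ x (3 ℕ.+ 4 ℕ.* K) 3 ⟨
        (x ^ (3 ℕ.+ 4 ℕ.* K)) ^ 3            ≈⟨ ^-congˡ 3 (x^[1+n]≈x x) ⟩
        x ^ 3                                ≈⟨ x^3≈x*x*x x ⟩
        x * x * x                            ∎
    }

  open FrobeniusRoot isDiscreteField char3 isSquareRootOfFrobenius using (f; f-cong; f-injective; f-odd)

  fpoly≈f : ∀ a x → fpoly F α a x ≈ f a x
  fpoly≈f a x =
    +-cong (+-cong x^[2α+3]≈σx*σx*x³ (^-distrib-* a x α)) (-‿cong (*-congʳ (*-congˡ (*-identityʳ a))))
    where
    x^[2α+3]≈σx*σx*x³ : x ^ (2 ℕ.* α ℕ.+ 3) ≈ σ x * σ x * (x * x * x)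
    x^[2α+3]≈σx*σx*x³ = begin
      x ^ (2 ℕ.* α ℕ.+ 3)            ≈⟨ ^-homo-* x (2 ℕ.* α) 3 ⟩
      x ^ (α ℕ.+ (α ℕ.+ 0)) * x ^ 3  ≈⟨ *-congʳ (^-homo-* x α (α ℕ.+ 0)) ⟩
      x ^ α * x ^ (α ℕ.+ 0) * x ^ 3  ≈⟨ *-cong (*-congˡ (^-congʳ x (ℕ.+-identityʳ α))) (x^3≈x*x*x x) ⟩
      σ x * σ x * (x * x * x)        ∎

  fpoly-cong : ∀ a → Congruent _≈_ _≈_ (fpoly F α a)
  fpoly-cong a x≈y = trans (fpoly≈f a _) (trans (f-cong refl x≈y) (sym (fpoly≈f a _)))

  fpoly-injective : ∀ a → Injective _≈_ _≈_ (fpoly F α a)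
  fpoly-injective a fx≈fy = f-injective a (trans (sym (fpoly≈f a _)) (trans fx≈fy (fpoly≈f a _)))

  fpoly-odd : ∀ a x → fpoly F α a (- x) ≈ - fpoly F α a x
  fpoly-odd a x = trans (fpoly≈f a (- x)) (trans (f-odd a x) (-‿cong (sym (fpoly≈f a x))))

open import Data.Nat using (_+_; _*_; _^_)

-- f_a is a permutation for every a.
lemma3p1 : {c ℓ : Level} (h : ℕ) (F : CommutativeRing c ℓ)
             → IsFiniteField F (3 ^ (2 * h + 1))
             → (a : CommutativeRing.Carrier F)
             → ¬ (CommutativeRing._≈_ F a (CommutativeRing.0# F))
             → (∀ y → ¬ (InD F (3 ^ (h + 1)) a y × InNegD F (3 ^ (h + 1)) a y))
               × (∀ y → InD F (3 ^ (h + 1)) a y ⊎ InNegD F (3 ^ (h + 1)) a y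
                        ⊎ CommutativeRing._≈_ F y (CommutativeRing.0# F))
lemma3p1 h F isFiniteField a _ = image-disjoint , image-covers
  where
  open PowersOfThree h isFiniteField
  open OrderThreeModFour.Partition {K = K} isFiniteField′
         (fpoly-cong a) (fpoly-injective a) (fpoly-odd a)
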